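{- Let $B$ be an $n\times n$ skew-symmetrizable integer matrix, and let $A$ and $A'$ be two admissible quasi-Cartan companions of $B$. Then $A'$ can be obtained from $A$ by a finite sequence of sign changes, where a sign change at an index $k$ multiplies the $k$-th row and the $k$-th column by $-1$. In particular, $A$ and $A'$ are equivalent.
   Context: An integer $n\times n$ matrix $B$ is skew-symmetrizable if $DB$ is skew-symmetric for some diagonal matrix $D$ with positive diagonal entries. The diagram $\Gamma(B)$ is the weighted directed graph on vertex set $\{1,\dots,n\}$ with a directed edge $i\to j$ iff $B_{i,j}>0$, carrying the weight $|B_{i,j}B_{j,i}|$. A cycle in $\Gamma(B)$ is an induced (full) subgraph on $r\ge 3$ vertices whose vertices can be labeled $1,\dots,r$ so that $i,j$ are adjacent iff $|i-j|=1$ or $\{i,j\}=\{1,r\}$. A cycle is oriented if its edges are cyclically oriented, and non-oriented otherwise. A quasi-Cartan matrix is an integer matrix $A$ that is symmetrizable (i.e. $DA$ is symmetric for some diagonal $D$ with positive diagonal entries) and has all diagonal entries equal to $2$. A quasi-Cartan companion of $B$ is a quasi-Cartan matrix $A$ with $|A_{i,j}|=|B_{i,j}|$ for all $i\ne j$. It is admissible if for every cycle $Z$ of $\Gamma(B)$ the product $\prod_{\{i,j\}\in Z}(-A_{i,j})$ over the edges of $Z$ is negative when $Z$ is oriented and positive when $Z$ is non-oriented. Two quasi-Cartan matrices $A,A'$ are equivalent if they have a common symmetrizer $D$ (diagonal with positive diagonal entries such that $C=DA$ and $C'=DA'$ are symmetric) and $C'=E^TCE$ for some integer matrix $E$ with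 $\det E=\pm1$. -}

module Defs where

open import Data.Nat using (ℕ; zero; suc; _≤_)
open import Data.Fin using (Fin; zero; suc; toℕ; punchIn)
open import Data.Integer using (ℤ; +_; -_; _+_; _*_; _<_; ∣_∣; 0ℤ; 1ℤ)
open import Data.List using (List; []; _∷_; foldl)
open import Data.Product using (Σ; _×_; _,_; ∃)
open import Data.Sum using (_⊎_)
open import Relation.Binary.PropositionalEquality using (_≡_; _≢_)
open import Relation.Nullary using (¬_)
open import Function.Bundles using (_⇔_)
open import Function.Definitions using (Injective)

Matrix : ℕ → Set
Matrix n = Fin n → Fin n → ℤ

sumFin : ∀ {n} → (Fin n → ℤ) → ℤ
sumFin {zero}  f = 0ℤ
sumFin {suc n} f = f zero + sumFin (λ i → f (suc i))

prodFin : ∀ {n} → (Fin n → ℤ) → ℤ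
prodFin {zero}  f = 1ℤ
prodFin {suc n} f = f zero * prodFin (λ i → f (suc i))

_·_ : ∀ {n} → Matrix n → Matrix n → Matrix n
(M · N) i k = sumFin (λ j → M i j * N j k)

transpose : ∀ {n} → Matrix n → Matrix n
transpose M i j = M j i

diag· : ∀ {n} → (Fin n → ℤ) → Matrix n → Matrix n
diag· d M i j = d i * M i j

altSign : ℕ → ℤ
altSign zero = 1ℤ
altSign (suc k) = - altSign k

det : ∀ {n} → Matrix n → ℤ
det {zero}  M = 1ℤ
det {suc n} M =
  sumFin (λ j → altSign (toℕ j) * (M zero j * det (λ a b → M (suc a) (punchIn j b))))

Positive : ∀ {n} → (Fin n → ℤ) → Set
Positive d = ∀ i → 0ℤ < d i

SkewSymmetrizer : ∀ {n} → (Fin n → ℤ) → Matrix n → Set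
SkewSymmetrizer d B = Positive d × (∀ i j → d i * B i j ≡ - (d j * B j i))

SkewSymmetrizable : ∀ {n} → Matrix n → Set
SkewSymmetrizable {n} B = Σ (Fin n → ℤ) λ d → SkewSymmetrizer d B

Symmetrizer : ∀ {n} → (Fin n → ℤ) → Matrix n → Set
Symmetrizer d A = Positive d × (∀ i j → d i * A i j ≡ d j * A j i)

Symmetrizable : ∀ {n} → Matrix n → Set
Symmetrizable {n} A = Σ (Fin n → ℤ) λ d → Symmetrizer d A

QuasiCartan : ∀ {n} → Matrix n → Set
QuasiCartan A = Symmetrizable A × (∀ i → A i i ≡ + 2)

QuasiCartanCompanion : ∀ {n} → Matrix n → Matrix n → Set
QuasiCartanCompanion B A = QuasiCartan A × (∀ i j → i ≢ j → ∣ A i j ∣ ≡ ∣ B i j ∣)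

cycSuc : ∀ {r} → Fin r → Fin r
cycSuc {suc zero} zero = zero
cycSuc {suc (suc r)} zero = suc zero
cycSuc {suc (suc r)} (suc a) with cycSuc {suc r} a
... | zero  = zero
... | suc b = suc (suc b)

CycAdj : ∀ {r} → Fin r → Fin r → Set
CycAdj a b = (cycSuc a ≡ b) ⊎ (cycSuc b ≡ a)

Adjacent : ∀ {n} → Matrix n → Fin n → Fin n → Set
Adjacent B i j = (0ℤ < B i j) ⊎ (0ℤ < B j i)

record Cycle {n : ℕ} (B : Matrix n) : Set where
  field
    r      : ℕ
    r≥3    : 3 ≤ r
    v      : Fin r → Fin n
    v-inj  : Injective _≡_ _≡_ v
    induced : ∀ a b → a ≢ b → (Adjacent B (v a) (v b) ⇔ CycAdj a b)

open Cycle public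

Oriented : ∀ {n} {B : Matrix n} → Cycle B → Set
Oriented {B = B} Z =
  (∀ a → 0ℤ < B (v Z a) (v Z (cycSuc a))) ⊎
  (∀ a → 0ℤ < B (v Z (cycSuc a)) (v Z a))

edgeProduct : ∀ {n} {B : Matrix n} → Matrix n → Cycle B → ℤ
edgeProduct A Z = prodFin (λ a → - A (v Z a) (v Z (cycSuc a)))

Admissible : ∀ {n} → Matrix n → Matrix n → Set
Admissible B A =
  ∀ (Z : Cycle B) →
    (Oriented Z → edgeProduct A Z < 0ℤ) × (¬ Oriented Z → 0ℤ < edgeProduct A Z)

AdmissibleCompanion : ∀ {n} → Matrix n → Matrix n → Set
AdmissibleCompanion B A = QuasiCartanCompanion B A × Admissible B A

signAt : ∀ {n} → Fin n → Fin n → ℤ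
signAt zero    zero    = - 1ℤ
signAt zero    (suc i) = 1ℤ
signAt (suc k) zero    = 1ℤ
signAt (suc k) (suc i) = signAt k i

signChange : ∀ {n} → Fin n → Matrix n → Matrix n
signChange k A i j = signAt k i * (signAt k j * A i j)

signChanges : ∀ {n} → List (Fin n) → Matrix n → Matrix n
signChanges ks A = foldl (λ M k → signChange k M) A ks

Equivalent : ∀ {n} → Matrix n → Matrix n → Set
Equivalent {n} A A' =
  Σ (Fin n → ℤ) λ d → Symmetrizer d A × Symmetrizer d A' ×
  Σ (Matrix n) λ E → ((det E ≡ 1ℤ) ⊎ (det E ≡ - 1ℤ)) ×
     (∀ i j → diag· d A' i j ≡ (transpose E · (diag· d A · E)) i j)

module Submission where

-- Since |A i j| = |A' i j| = |B i j|, A' arises from A by flipping the signs of the entries on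
-- a set of edges of Γ(B), and symmetrizability makes this set symmetric. Admissibility of both
-- matrices fixes the sign of the product of -A i j around every chordless cycle, so each such
-- cycle contains an even number of flipped edges. A signing of a graph that is balanced on its
-- chordless cycles is a coboundary ε i j = s i s j: delete a vertex and join its neighbours into
-- a clique whose new edges are signed along the path through the deleted vertex; a chordless
-- cycle of the new graph is either a chordless cycle of the old one, or a triangle inside the
-- clique, or becomes one of the old graph when its unique new edge is rerouted through the
-- deleted vertex. Hence A' = S A S with S = diag s, which is the product of the sign changes at
-- the k with s k = -1, and Sᵀ (D A) S = D A' with det S = ±1.

open import Defs
open import Algebra.Bundles using (CommutativeRing)
open import Data.Bool using (Bool; true; false; _xor_; if_then_else_)
open import Data.Bool.Properties
  using (xor-∧-commutativeRing; xor-assoc; xor-comm; xor-same)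
open import Data.Empty using (⊥-elim)
open import Data.Fin using (Fin; zero; suc; toℕ; fromℕ; inject₁)
open import Data.Fin.Properties
  using (suc-injective; toℕ-inject₁; fromℕ≢inject₁; inject₁-injective; all?; any?; ¬∀⟶∃¬; _≟_)
open import Data.Fin.Relation.Unary.Top using (view; ‵fromℕ; ‵inject₁)
open import Data.Integer as ℤ
  using (ℤ; +_; -_; _*_; _<_; ∣_∣; 0ℤ; 1ℤ; -1ℤ; +[1+_]; -[1+_]; +<+)
open import Data.Integer.Properties
  using ( _<?_; <-cmp; <-asym; neg-mono-<; *-zeroˡ; *-zeroʳ; *-identityˡ; *-identityʳ
        ; +-identityˡ; +-identityʳ; -1*i≡-i; neg-involutive; neg-distribʳ-*; *-monoˡ-<-pos
        ; *-cancelˡ-<-nonNeg; ∣i∣≡0⇒i≡0; *-assoc; *-commutativeSemigroup)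
open import Data.Integer.Tactic.RingSolver using (solve-∀)
open import Data.List using (List; []; _∷_; map)
open import Data.Nat using (ℕ; zero; suc; _+_; pred; z≤n; s≤s)
open import Data.Nat.GeneralisedArithmetic using (iterate)
open import Data.Nat.Properties using (1+n≢n)
open import Data.Product using (Σ; _×_; _,_; proj₁; proj₂)
import Data.Product as Prod
open import Data.Sum using (_⊎_; inj₁; inj₂)
import Data.Sum as Sum
open import Function.Base using (_∘_)
open import Function.Bundles using (_⇔_; mk⇔; Equivalence)
open import Function.Definitions using (Injective)
import Function.Properties.Equivalence as ⇔
open import Relation.Binary using (tri<; tri≈; tri>)
open import Relation.Binary.PropositionalEquality
open import Relation.Nullary using (¬_; Dec; yes; no; does; ¬?)
open import Relation.Nullary.Decidable using (_⊎-dec_; _×-dec_; does-⇔)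
open import Algebra.Properties.CommutativeMonoid.Sum
  (CommutativeRing.+-commutativeMonoid xor-∧-commutativeRing)
  using (sum; sum-cong-≗; sum-init-last; ∑-distrib-+)
open import Algebra.Properties.CommutativeSemigroup *-commutativeSemigroup using (interchange; x∙yz≈y∙xz)
open Equivalence using (to; from)
open ≡-Reasoning

-- Positions on a cycle

cycSuc-inject₁ : ∀ {m} (a : Fin m) → cycSuc {suc m} (inject₁ a) ≡ suc a
cycSuc-inject₁ {suc m} zero = refl
cycSuc-inject₁ {suc (suc m)} (suc a) rewrite cycSuc-inject₁ {suc m} a = refl

cycSuc-fromℕ : ∀ m → cycSuc {suc m} (fromℕ m) ≡ zero
cycSuc-fromℕ zero = refl
cycSuc-fromℕ (suc m) rewrite cycSuc-fromℕ m = refl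

cycSuc-injective : ∀ {r} → Injective _≡_ _≡_ (cycSuc {r})
cycSuc-injective {suc m} {a} {b} eq with view a | view b
... | ‵inject₁ x | ‵inject₁ y =
      cong inject₁ (suc-injective (trans (sym (cycSuc-inject₁ x)) (trans eq (cycSuc-inject₁ y))))
... | ‵inject₁ x | ‵fromℕ with () ← trans (sym (cycSuc-inject₁ x)) (trans eq (cycSuc-fromℕ m))
... | ‵fromℕ | ‵inject₁ y with () ← trans (sym (cycSuc-fromℕ m)) (trans eq (cycSuc-inject₁ y))
... | ‵fromℕ | ‵fromℕ = refl

cycSuc-≢ : ∀ {m} (a : Fin (suc (suc m))) → a ≢ cycSuc a
cycSuc-≢ a eq with view a
... | ‵inject₁ x = 1+n≢n (sym (trans (sym (toℕ-inject₁ x)) (cong toℕ (trans eq (cycSuc-inject₁ x)))))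
... | ‵fromℕ with () ← trans eq (cycSuc-fromℕ _)

CycAdj-sym : ∀ {r} {a b : Fin r} → CycAdj a b → CycAdj b a
CycAdj-sym = Sum.swap

cycSuc-inject₁≡inject₁⇔ : ∀ {m} (x y : Fin (suc m)) →
  (cycSuc {suc (suc m)} (inject₁ x) ≡ inject₁ y) ⇔ (cycSuc x ≡ y × x ≢ fromℕ m)
cycSuc-inject₁≡inject₁⇔ {m} x y with view x
... | ‵inject₁ x' = mk⇔
  (λ e → trans (cycSuc-inject₁ x') (inject₁-injective (trans (sym (cycSuc-inject₁ (inject₁ x'))) e))
       , λ e' → fromℕ≢inject₁ (sym e'))
  (λ (e , _) → trans (cycSuc-inject₁ (inject₁ x')) (cong inject₁ (trans (sym (cycSuc-inject₁ x')) e)))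
... | ‵fromℕ = mk⇔
  (λ e → ⊥-elim (fromℕ≢inject₁ (trans (sym (cycSuc-inject₁ (fromℕ m))) e)))
  (λ (_ , x≢last) → ⊥-elim (x≢last refl))

CycAdj-inject₁-fromℕ⇔ : ∀ {m} (x : Fin (suc m)) →
  CycAdj {suc (suc m)} (inject₁ x) (fromℕ (suc m)) ⇔ (x ≡ fromℕ m ⊎ x ≡ zero)
CycAdj-inject₁-fromℕ⇔ {m} x = mk⇔
  (Sum.map (λ e → suc-injective (trans (sym (cycSuc-inject₁ x)) e))
           (λ e → inject₁-injective (trans (sym e) (cycSuc-fromℕ (suc m)))))
  (Sum.map (λ e → trans (cycSuc-inject₁ x) (cong suc e))
           (λ e → trans (cycSuc-fromℕ (suc m)) (cong inject₁ (sym e))))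

cycSuc-iterate : ∀ {r} (a : Fin r) k → cycSuc (iterate cycSuc a k) ≡ iterate cycSuc (cycSuc a) k
cycSuc-iterate a zero    = refl
cycSuc-iterate a (suc k) = cycSuc-iterate (cycSuc a) k

iterate-cycSuc-injective : ∀ {r} k → Injective _≡_ _≡_ (λ (a : Fin r) → iterate cycSuc a k)
iterate-cycSuc-injective zero    e = e
iterate-cycSuc-injective (suc k) e = cycSuc-injective (iterate-cycSuc-injective k e)

iterate-cycSuc-zero : ∀ {m} t (a : Fin (suc m)) → toℕ a ≡ t → iterate cycSuc zero t ≡ a
iterate-cycSuc-zero zero    zero    _  = refl
iterate-cycSuc-zero {suc m} (suc t) (suc a) eq = begin
  iterate cycSuc (cycSuc zero) t  ≡⟨ cycSuc-iterate zero t ⟨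
  cycSuc (iterate cycSuc zero t)  ≡⟨ cong cycSuc (iterate-cycSuc-zero t (inject₁ a) toℕ-inject₁a≡t) ⟩
  cycSuc (inject₁ a)              ≡⟨ cycSuc-inject₁ a ⟩
  suc a                           ∎
  where
  toℕ-inject₁a≡t : toℕ (inject₁ a) ≡ t
  toℕ-inject₁a≡t = trans (toℕ-inject₁ a) (cong pred eq)

CycAdj-zero⇒one : ∀ {k} (c : Fin (3 + k)) → c ≢ fromℕ (2 + k) → CycAdj c zero → c ≡ suc zero
CycAdj-zero⇒one c c≢last (inj₁ e) = ⊥-elim (c≢last (cycSuc-injective (trans e (sym (cycSuc-fromℕ _)))))
CycAdj-zero⇒one c _      (inj₂ e) = sym e

CycAdj-one-fromℕ⇒k≡0 : ∀ k → CycAdj {3 + k} (suc zero) (fromℕ (2 + k)) → k ≡ 0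
CycAdj-one-fromℕ⇒k≡0 zero    _        = refl
CycAdj-one-fromℕ⇒k≡0 (suc k) (inj₁ ())
CycAdj-one-fromℕ⇒k≡0 (suc k) (inj₂ e) with () ← trans (sym (cycSuc-fromℕ (3 + k))) e

CycAdj-Fin3 : ∀ (p q : Fin 3) → p ≢ q → CycAdj p q
CycAdj-Fin3 zero             zero             p≢q = ⊥-elim (p≢q refl)
CycAdj-Fin3 zero             (suc zero)       _   = inj₁ refl
CycAdj-Fin3 zero             (suc (suc zero)) _   = inj₂ refl
CycAdj-Fin3 (suc zero)       zero             _   = inj₂ refl
CycAdj-Fin3 (suc zero)       (suc zero)       p≢q = ⊥-elim (p≢q refl)
CycAdj-Fin3 (suc zero)       (suc (suc zero)) _   = inj₁ refl
CycAdj-Fin3 (suc (suc zero)) zero             _   = inj₁ refl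
CycAdj-Fin3 (suc (suc zero)) (suc zero)       _   = inj₂ refl
CycAdj-Fin3 (suc (suc zero)) (suc (suc zero)) p≢q = ⊥-elim (p≢q refl)

rotation : ∀ {m} → Fin (suc m) → Fin (suc m) → Fin (suc m)
rotation a p = iterate cycSuc p (toℕ (cycSuc a))

rotation-cycSuc : ∀ {m} (a p : Fin (suc m)) → cycSuc (rotation a p) ≡ rotation a (cycSuc p)
rotation-cycSuc a p = cycSuc-iterate p (toℕ (cycSuc a))

rotation-injective : ∀ {m} (a : Fin (suc m)) → Injective _≡_ _≡_ (rotation a)
rotation-injective a = iterate-cycSuc-injective (toℕ (cycSuc a))

rotation-zero : ∀ {m} (a : Fin (suc m)) → rotation a zero ≡ cycSuc a
rotation-zero a = iterate-cycSuc-zero _ (cycSuc a) refl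

rotation-fromℕ : ∀ {m} (a : Fin (suc m)) → rotation a (fromℕ m) ≡ a
rotation-fromℕ {m} a = cycSuc-injective (begin
  cycSuc (rotation a (fromℕ m))  ≡⟨ rotation-cycSuc a (fromℕ m) ⟩
  rotation a (cycSuc (fromℕ m))  ≡⟨ cong (rotation a) (cycSuc-fromℕ m) ⟩
  rotation a zero                ≡⟨ rotation-zero a ⟩
  cycSuc a                       ∎)

CycAdj-rotation⇔ : ∀ {m} (a p q : Fin (suc m)) → CycAdj (rotation a p) (rotation a q) ⇔ CycAdj p q
CycAdj-rotation⇔ a p q = mk⇔
  (Sum.map (λ e → rotation-injective a (trans (sym (rotation-cycSuc a p)) e))
           (λ e → rotation-injective a (trans (sym (rotation-cycSuc a q)) e)))
  (Sum.map (λ e → trans (rotation-cycSuc a p) (cong (rotation a) e))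
           (λ e → trans (rotation-cycSuc a q) (cong (rotation a) e)))

xor-move : ∀ a b {c} → a xor b ≡ c → b ≡ a xor c
xor-move a b refl = begin
  b                ≡⟨ cong (_xor b) (xor-same a) ⟨
  (a xor a) xor b  ≡⟨ xor-assoc a a b ⟩
  a xor (a xor b)  ∎

xor-triangle : ∀ a b c → a xor (b xor (c xor false)) ≡ false → b ≡ a xor c
xor-triangle false false false _ = refl
xor-triangle false false true  ()
xor-triangle false true  false ()
xor-triangle false true  true  _ = refl
xor-triangle true  false false ()
xor-triangle true  false true  _ = refl
xor-triangle true  true  false _ = refl
xor-triangle true  true  true  ()

sum-cycSuc : ∀ {r} (g : Fin r → Bool) → sum (g ∘ cycSuc) ≡ sum g
sum-cycSuc {zero}  g = refl
sum-cycSuc {suc m} g = begin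
  sum (g ∘ cycSuc)
    ≡⟨ sum-init-last (g ∘ cycSuc) ⟩
  sum (g ∘ cycSuc ∘ inject₁) xor g (cycSuc (fromℕ m))
    ≡⟨ cong₂ _xor_ (sum-cong-≗ (cong g ∘ cycSuc-inject₁)) (cong g (cycSuc-fromℕ m)) ⟩
  sum (g ∘ suc) xor g zero
    ≡⟨ xor-comm (sum (g ∘ suc)) (g zero) ⟩
  sum g ∎

sum-rotation : ∀ {m} (g : Fin (suc m) → Bool) (a : Fin (suc m)) → sum (g ∘ rotation a) ≡ sum g
sum-rotation g a = sum-iterate g (toℕ (cycSuc a))
  where
  sum-iterate : ∀ {r} (g : Fin r → Bool) k → sum (λ p → g (iterate cycSuc p k)) ≡ sum g
  sum-iterate g zero    = refl
  sum-iterate g (suc k) = trans (sum-cycSuc (λ p → g (iterate cycSuc p k))) (sum-iterate g k)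

sum-coboundary : ∀ {r} (g : Fin r → Bool) → sum (λ a → g a xor g (cycSuc a)) ≡ false
sum-coboundary g = begin
  sum (λ a → g a xor g (cycSuc a))  ≡⟨ ∑-distrib-+ g (g ∘ cycSuc) ⟩
  sum g xor sum (g ∘ cycSuc)        ≡⟨ cong (sum g xor_) (sum-cycSuc g) ⟩
  sum g xor sum g                   ≡⟨ xor-same (sum g) ⟩
  false                             ∎

snoc : ∀ {A : Set} {k} → (Fin k → A) → A → Fin (suc k) → A
snoc {k = zero}  f x zero    = x
snoc {k = suc k} f x zero    = f zero
snoc {k = suc k} f x (suc p) = snoc (f ∘ suc) x p

snoc-inject₁ : ∀ {A : Set} {k} (f : Fin k → A) (x : A) p → snoc f x (inject₁ p) ≡ f p
snoc-inject₁ {k = suc k} f x zero    = refl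
snoc-inject₁ {k = suc k} f x (suc p) = snoc-inject₁ (f ∘ suc) x p

snoc-fromℕ : ∀ {A : Set} {k} (f : Fin k → A) (x : A) → snoc f x (fromℕ k) ≡ x
snoc-fromℕ {k = zero}  f x = refl
snoc-fromℕ {k = suc k} f x = snoc-fromℕ (f ∘ suc) x

-- Balanced signed graphs

Induced : ∀ {n r} → (Fin n → Fin n → Set) → (Fin r → Fin n) → Set
Induced Edge v = ∀ a b → a ≢ b → Edge (v a) (v b) ⇔ CycAdj a b

induced-∘rotation : ∀ {n m} {Edge : Fin n → Fin n → Set} (v : Fin (suc m) → Fin n) (a : Fin (suc m)) →
                    Induced Edge v → Induced Edge (v ∘ rotation a)
induced-∘rotation v a v-ind p q p≢q =
  ⇔.trans (v-ind _ _ (p≢q ∘ rotation-injective a)) (CycAdj-rotation⇔ a p q)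

-- Edge labels are signs, true standing for -1.
record SignedGraph (n : ℕ) : Set₁ where
  field
    Edge      : Fin n → Fin n → Set
    edge?     : ∀ i j → Dec (Edge i j)
    edge-sym  : ∀ {i j} → Edge i j → Edge j i
    label     : Fin n → Fin n → Bool
    label-sym : ∀ {i j} → Edge i j → label i j ≡ label j i

  parity : ∀ {r} → (Fin r → Fin n) → Bool
  parity v = sum (λ a → label (v a) (v (cycSuc a)))

  Balanced : Set
  Balanced = ∀ {k} (v : Fin (3 + k) → Fin n) → Injective _≡_ _≡_ v → Induced Edge v → parity v ≡ false

  Coboundary : Set
  Coboundary = Σ (Fin n → Bool) λ σ → ∀ {i j} → i ≢ j → Edge i j → label i j ≡ σ i xor σ j

  parity-∘rotation : ∀ {m} (v : Fin (suc m) → Fin n) a → parity (v ∘ rotation a) ≡ parity v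
  parity-∘rotation v a = begin
    sum (λ p → label (v (rotation a p)) (v (rotation a (cycSuc p))))
      ≡⟨ sum-cong-≗ (λ p → cong (label (v (rotation a p)) ∘ v) (rotation-cycSuc a p)) ⟨
    sum (λ p → label (v (rotation a p)) (v (cycSuc (rotation a p))))
      ≡⟨ sum-rotation (λ q → label (v q) (v (cycSuc q))) a ⟩
    parity v ∎

  consecutive⇒edge : ∀ {r} (v : Fin r → Fin n) → (∀ a → Edge (v a) (v (cycSuc a))) →
                     ∀ {a b} → CycAdj a b → Edge (v a) (v b)
  consecutive⇒edge v consecutive (inj₁ refl) = consecutive _
  consecutive⇒edge v consecutive (inj₂ refl) = edge-sym (consecutive _)

  triangle-parity : ∀ {a b c} → a ≢ b → b ≢ c → c ≢ a → Edge a b → Edge b c → Edge c a →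
             Balanced → label a b xor (label b c xor (label c a xor false)) ≡ false
  triangle-parity {a} {b} {c} a≢b b≢c c≢a ab bc ca balanced = balanced t t-injective t-induced
    where
    t : Fin 3 → Fin n
    t zero             = a
    t (suc zero)       = b
    t (suc (suc zero)) = c

    t-injective : Injective _≡_ _≡_ t
    t-injective {zero}             {zero}             _ = refl
    t-injective {zero}             {suc zero}         e = ⊥-elim (a≢b e)
    t-injective {zero}             {suc (suc zero)}   e = ⊥-elim (c≢a (sym e))
    t-injective {suc zero}         {zero}             e = ⊥-elim (a≢b (sym e))
    t-injective {suc zero}         {suc zero}         _ = refl
    t-injective {suc zero}         {suc (suc zero)}   e = ⊥-elim (b≢c e)
    t-injective {suc (suc zero)}   {zero}             e = ⊥-elim (c≢a e)
    t-injective {suc (suc zero)}   {suc zero}         e = ⊥-elim (b≢c (sym e))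
    t-injective {suc (suc zero)}   {suc (suc zero)}   _ = refl

    t-induced : Induced Edge t
    t-induced p q p≢q =
      mk⇔ (λ _ → CycAdj-Fin3 p q p≢q)
          (consecutive⇒edge t λ { zero → ab ; (suc zero) → bc ; (suc (suc zero)) → ca })

-- Deleting vertex 0 and joining its neighbours into a clique, the new edges
-- x — y being labelled by the path x — 0 — y.
module Elimination {n} (G : SignedGraph (suc n)) (balanced : SignedGraph.Balanced G) where
  open SignedGraph G

  Nbr : Fin n → Set
  Nbr x = Edge zero (suc x)

  nbr? : ∀ x → Dec (Nbr x)
  nbr? x = edge? zero (suc x)

  label₀ : Fin n → Bool
  label₀ x = label zero (suc x)

  label' : Fin n → Fin n → Bool
  label' x y with edge? (suc x) (suc y)
  ... | yes _ = label (suc x) (suc y)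
  ... | no  _ = label₀ x xor label₀ y

  label'-old : ∀ {x y} → Edge (suc x) (suc y) → label' x y ≡ label (suc x) (suc y)
  label'-old {x} {y} e with edge? (suc x) (suc y)
  ... | yes _ = refl
  ... | no ¬e = ⊥-elim (¬e e)

  label'-new : ∀ {x y} → ¬ Edge (suc x) (suc y) → label' x y ≡ label₀ x xor label₀ y
  label'-new {x} {y} ¬e with edge? (suc x) (suc y)
  ... | yes e = ⊥-elim (¬e e)
  ... | no _  = refl

  label'-sym : ∀ x y → label' x y ≡ label' y x
  label'-sym x y with edge? (suc x) (suc y) | edge? (suc y) (suc x)
  ... | yes e  | yes _   = label-sym e
  ... | yes e  | no ¬e'  = ⊥-elim (¬e' (edge-sym e))
  ... | no ¬e  | yes e'  = ⊥-elim (¬e (edge-sym e'))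
  ... | no _   | no _    = xor-comm (label₀ x) (label₀ y)

  G' : SignedGraph n
  G' = record
    { Edge      = λ x y → Edge (suc x) (suc y) ⊎ (Nbr x × Nbr y)
    ; edge?     = λ x y → edge? (suc x) (suc y) ⊎-dec (nbr? x ×-dec nbr? y)
    ; edge-sym  = Sum.map edge-sym Prod.swap
    ; label     = label'
    ; label-sym = λ {x} {y} _ → label'-sym x y
    }

  open SignedGraph G' using ()
    renaming ( Edge to Edge'; parity to parity'; Coboundary to Coboundary'
             ; parity-∘rotation to parity'-∘rotation)

  label'-nbrs : ∀ {x y} → x ≢ y → Nbr x → Nbr y → label' x y ≡ label₀ x xor label₀ y
  label'-nbrs {x} {y} x≢y nx ny with edge? (suc x) (suc y)
  ... | no _  = refl
  ... | yes e = begin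
    label (suc x) (suc y)
      ≡⟨ xor-triangle (label₀ x) (label (suc x) (suc y)) (label (suc y) zero) triangle-0xy ⟩
    label₀ x xor label (suc y) zero
      ≡⟨ cong (label₀ x xor_) (label-sym (edge-sym ny)) ⟩
    label₀ x xor label₀ y ∎
    where
    triangle-0xy : label₀ x xor (label (suc x) (suc y) xor (label (suc y) zero xor false)) ≡ false
    triangle-0xy = triangle-parity (λ ()) (x≢y ∘ suc-injective) (λ ()) nx e (edge-sym ny) balanced

  parity'-allNbrs : ∀ {m} (w : Fin (2 + m) → Fin n) → Injective _≡_ _≡_ w → (∀ p → Nbr (w p)) →
                    parity' w ≡ false
  parity'-allNbrs w w-inj nbr =
    trans (sum-cong-≗ λ p → label'-nbrs (cycSuc-≢ p ∘ w-inj) (nbr p) (nbr (cycSuc p)))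
          (sum-coboundary (label₀ ∘ w))

  parity'-oldEdges : ∀ {k} (v : Fin (3 + k) → Fin n) → Injective _≡_ _≡_ v → Induced Edge' v →
                     (∀ a → Edge (suc (v a)) (suc (v (cycSuc a)))) → parity' v ≡ false
  parity'-oldEdges v v-inj v-ind old = begin
    parity' v         ≡⟨ sum-cong-≗ (λ a → label'-old (old a)) ⟩
    parity (suc ∘ v)  ≡⟨ balanced (suc ∘ v) (v-inj ∘ suc-injective) lifted ⟩
    false             ∎
    where
    lifted : Induced Edge (suc ∘ v)
    lifted a b a≢b = mk⇔ (to (v-ind a b a≢b) ∘ inj₁) (consecutive⇒edge (suc ∘ v) old)

  -- Only a triangle can have three vertices in the clique of neighbours of 0.
  parity'-thirdNbr : ∀ {k} (w : Fin (3 + k) → Fin n) → Injective _≡_ _≡_ w → Induced Edge' w →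
                     Nbr (w (fromℕ (2 + k))) → Nbr (w zero) →
                     ∀ c → c ≢ fromℕ (2 + k) → c ≢ zero → Nbr (w c) → parity' w ≡ false
  parity'-thirdNbr {k} w w-inj w-ind nl n0 c c≢last c≢0 nc
    with CycAdj-zero⇒one c c≢last (to (w-ind c zero c≢0) (inj₂ (nc , n0)))
  ... | refl with CycAdj-one-fromℕ⇒k≡0 k (to (w-ind (suc zero) (fromℕ (2 + k)) c≢last) (inj₂ (nc , nl)))
  ...   | refl = parity'-allNbrs w w-inj λ { zero → n0 ; (suc zero) → nc ; (suc (suc zero)) → nl }

  -- Rerouting the new last edge through 0 gives an induced cycle of G with the same parity.
  module Detour {k} (w : Fin (3 + k) → Fin n) (w-inj : Injective _≡_ _≡_ w) (w-ind : Induced Edge' w)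
    (new : ¬ Edge (suc (w (fromℕ (2 + k)))) (suc (w zero)))
    (nl : Nbr (w (fromℕ (2 + k)))) (n0 : Nbr (w zero))
    (onlyEnds : ∀ c → Nbr (w c) → c ≡ fromℕ (2 + k) ⊎ c ≡ zero) where

    m : ℕ
    m = 2 + k

    last : Fin (suc m)
    last = fromℕ m

    W : Fin (2 + m) → Fin (suc n)
    W = snoc (suc ∘ w) zero

    W-inject₁ : ∀ x → W (inject₁ x) ≡ suc (w x)
    W-inject₁ = snoc-inject₁ (suc ∘ w) zero

    W-fromℕ : W (fromℕ (suc m)) ≡ zero
    W-fromℕ = snoc-fromℕ (suc ∘ w) zero

    consecutive-old : ∀ x → x ≢ last → Edge (suc (w x)) (suc (w (cycSuc x)))
    consecutive-old x x≢last with from (w-ind x (cycSuc x) (cycSuc-≢ x)) (inj₁ refl)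
    ... | inj₁ old = old
    ... | inj₂ (nx , nsx) with onlyEnds x nx
    ...   | inj₁ x≡last = ⊥-elim (x≢last x≡last)
    ...   | inj₂ refl with onlyEnds (suc zero) nsx
    ...     | inj₁ ()
    ...     | inj₂ ()

    notWrap : ∀ {x y} → cycSuc x ≡ y → Edge (suc (w x)) (suc (w y)) → x ≢ last
    notWrap e old refl =
      new (subst (λ z → Edge (suc (w last)) (suc (w z))) (trans (sym e) (cycSuc-fromℕ m)) old)

    forward : ∀ {x y} → cycSuc x ≡ y → Edge (suc (w x)) (suc (w y)) → cycSuc (inject₁ x) ≡ inject₁ y
    forward e old = from (cycSuc-inject₁≡inject₁⇔ _ _) (e , notWrap e old)

    backward : ∀ {x y} → cycSuc {2 + m} (inject₁ x) ≡ inject₁ y → Edge (suc (w x)) (suc (w y))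
    backward {x} {y} c with to (cycSuc-inject₁≡inject₁⇔ x y) c
    ... | e , x≢last = subst (λ z → Edge (suc (w x)) (suc (w z))) e (consecutive-old x x≢last)

    W-inner : ∀ x y → x ≢ y → Edge (suc (w x)) (suc (w y)) ⇔ CycAdj {2 + m} (inject₁ x) (inject₁ y)
    W-inner x y x≢y = mk⇔
      (λ old → Sum.map (λ e → forward e old) (λ e → forward e (edge-sym old)) (to (w-ind x y x≢y) (inj₁ old)))
      Sum.[ backward , edge-sym ∘ backward ]

    W-toRoot : ∀ x → Edge (suc (w x)) zero ⇔ CycAdj {2 + m} (inject₁ x) (fromℕ (suc m))
    W-toRoot x = ⇔.trans (mk⇔ edge-sym edge-sym)
                 (⇔.trans (mk⇔ (onlyEnds x) Sum.[ (λ { refl → nl }) , (λ { refl → n0 }) ])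
                          (⇔.sym (CycAdj-inject₁-fromℕ⇔ x)))

    W-injective : Injective _≡_ _≡_ W
    W-injective {p} {q} e with view p | view q
    ... | ‵inject₁ x | ‵inject₁ y =
          cong inject₁ (w-inj (suc-injective (trans (sym (W-inject₁ x)) (trans e (W-inject₁ y)))))
    ... | ‵inject₁ x | ‵fromℕ with () ← trans (sym (W-inject₁ x)) (trans e W-fromℕ)
    ... | ‵fromℕ | ‵inject₁ y with () ← trans (sym W-fromℕ) (trans e (W-inject₁ y))
    ... | ‵fromℕ | ‵fromℕ = refl

    W-induced : Induced Edge W
    W-induced p q p≢q with view p | view q
    ... | ‵inject₁ x | ‵inject₁ y rewrite W-inject₁ x | W-inject₁ y = W-inner x y (p≢q ∘ cong inject₁)
    ... | ‵inject₁ x | ‵fromℕ rewrite W-inject₁ x | W-fromℕ = W-toRoot x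
    ... | ‵fromℕ | ‵inject₁ y rewrite W-inject₁ y | W-fromℕ =
          ⇔.trans (mk⇔ edge-sym edge-sym) (⇔.trans (W-toRoot y) (mk⇔ CycAdj-sym CycAdj-sym))
    ... | ‵fromℕ | ‵fromℕ = ⊥-elim (p≢q refl)

    F : Fin (2 + m) → Bool
    F p = label (W p) (W (cycSuc p))

    H : Fin (suc m) → Bool
    H p = label' (w p) (w (cycSuc p))

    F-inner : ∀ y → F (inject₁ (inject₁ y)) ≡ H (inject₁ y)
    F-inner y = begin
      label (W (inject₁ (inject₁ y))) (W (cycSuc (inject₁ (inject₁ y))))
        ≡⟨ cong₂ label (W-inject₁ (inject₁ y))
                       (trans (cong W (cycSuc-inject₁ (inject₁ y))) (W-inject₁ (suc y))) ⟩
      label (suc (w (inject₁ y))) (suc (w (suc y)))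
        ≡⟨ cong (label (suc (w (inject₁ y))) ∘ suc ∘ w) (cycSuc-inject₁ y) ⟨
      label (suc (w (inject₁ y))) (suc (w (cycSuc (inject₁ y))))
        ≡⟨ label'-old (consecutive-old (inject₁ y) (λ e → fromℕ≢inject₁ (sym e))) ⟨
      H (inject₁ y) ∎

    F-toRoot : F (inject₁ last) ≡ label₀ (w last)
    F-toRoot = trans (cong₂ label (W-inject₁ last) (trans (cong W (cycSuc-inject₁ last)) W-fromℕ))
                     (label-sym (edge-sym nl))

    F-fromRoot : F (fromℕ (suc m)) ≡ label₀ (w zero)
    F-fromRoot = cong₂ label W-fromℕ (cong W (cycSuc-fromℕ (suc m)))

    H-last : H last ≡ label₀ (w last) xor label₀ (w zero)
    H-last = trans (cong (label' (w last) ∘ w) (cycSuc-fromℕ m)) (label'-new new)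

    parity-W : parity W ≡ parity' w
    parity-W = begin
      sum F
        ≡⟨ sum-init-last F ⟩
      sum (F ∘ inject₁) xor F (fromℕ (suc m))
        ≡⟨ cong (_xor F (fromℕ (suc m))) (sum-init-last (F ∘ inject₁)) ⟩
      (sum (F ∘ inject₁ ∘ inject₁) xor F (inject₁ last)) xor F (fromℕ (suc m))
        ≡⟨ cong₂ _xor_ (cong₂ _xor_ (sum-cong-≗ F-inner) F-toRoot) F-fromRoot ⟩
      (sum (H ∘ inject₁) xor label₀ (w last)) xor label₀ (w zero)
        ≡⟨ xor-assoc (sum (H ∘ inject₁)) (label₀ (w last)) (label₀ (w zero)) ⟩
      sum (H ∘ inject₁) xor (label₀ (w last) xor label₀ (w zero))
        ≡⟨ cong (sum (H ∘ inject₁) xor_) H-last ⟨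
      sum (H ∘ inject₁) xor H last
        ≡⟨ sum-init-last H ⟨
      sum H ∎

    parity'-detour : parity' w ≡ false
    parity'-detour = trans (sym parity-W) (balanced W W-injective W-induced)

  parity'-newLastEdge : ∀ {k} (w : Fin (3 + k) → Fin n) → Injective _≡_ _≡_ w → Induced Edge' w →
                        ¬ Edge (suc (w (fromℕ (2 + k)))) (suc (w zero)) → parity' w ≡ false
  parity'-newLastEdge {k} w w-inj w-ind new
    with from (w-ind (fromℕ (2 + k)) zero (λ ())) (inj₁ (cycSuc-fromℕ (2 + k)))
  ... | inj₁ old = ⊥-elim (new old)
  ... | inj₂ (nl , n0) with any? (λ c → ¬? (c ≟ fromℕ (2 + k)) ×-dec (¬? (c ≟ zero) ×-dec nbr? (w c)))
  ...   | yes (c , c≢last , c≢0 , nc) = parity'-thirdNbr w w-inj w-ind nl n0 c c≢last c≢0 nc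
  ...   | no noThird = Detour.parity'-detour w w-inj w-ind new nl n0 onlyEnds
    where
    onlyEnds : ∀ c → Nbr (w c) → c ≡ fromℕ (2 + k) ⊎ c ≡ zero
    onlyEnds c nc with c ≟ fromℕ (2 + k) | c ≟ zero
    ... | yes c≡last | _        = inj₁ c≡last
    ... | no _       | yes c≡0  = inj₂ c≡0
    ... | no c≢last  | no c≢0   = ⊥-elim (noThird (c , c≢last , c≢0 , nc))

  balanced' : SignedGraph.Balanced G'
  balanced' v v-inj v-ind with all? (λ a → edge? (suc (v a)) (suc (v (cycSuc a))))
  ... | yes old = parity'-oldEdges v v-inj v-ind old
  ... | no ¬old with ¬∀⟶∃¬ _ _ (λ a → edge? (suc (v a)) (suc (v (cycSuc a)))) ¬old
  ...   | a , new = begin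
    parity' v                 ≡⟨ parity'-∘rotation v a ⟨
    parity' (v ∘ rotation a)  ≡⟨ parity'-newLastEdge (v ∘ rotation a) (λ e → rotation-injective a (v-inj e))
                                   (induced-∘rotation {Edge = Edge'} v a v-ind) rotated-new ⟩
    false                     ∎
    where
    rotated-new : ¬ Edge (suc (v (rotation a (fromℕ _)))) (suc (v (rotation a zero)))
    rotated-new = new ∘ subst₂ (λ p q → Edge (suc (v p)) (suc (v q))) (rotation-fromℕ a) (rotation-zero a)

  coboundary-lift : Coboundary' → Coboundary
  coboundary-lift (σ' , σ'-ok) = σ , σ-ok
    where
    root : Σ Bool λ s → ∀ y → Nbr y → label₀ y ≡ s xor σ' y
    root with any? nbr?
    ... | no none = false , λ y ny → ⊥-elim (none (y , ny))
    ... | yes (j , nj) = label₀ j xor σ' j , λ y ny →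
          trans (xor-move (label₀ j) (label₀ y) (agree y ny)) (sym (xor-assoc (label₀ j) (σ' j) (σ' y)))
      where
      agree : ∀ y → Nbr y → label₀ j xor label₀ y ≡ σ' j xor σ' y
      agree y ny with j ≟ y
      ... | yes refl = trans (xor-same (label₀ j)) (sym (xor-same (σ' j)))
      ... | no j≢y   = trans (sym (label'-nbrs j≢y nj ny)) (σ'-ok j≢y (inj₂ (nj , ny)))

    σ₀ : Bool
    σ₀ = proj₁ root

    σ : Fin (suc n) → Bool
    σ zero    = σ₀
    σ (suc x) = σ' x

    σ-ok : ∀ {i j} → i ≢ j → Edge i j → label i j ≡ σ i xor σ j
    σ-ok {zero}  {zero}  0≢0 _ = ⊥-elim (0≢0 refl)
    σ-ok {zero}  {suc y} _   e = proj₂ root y e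
    σ-ok {suc x} {zero}  _   e = trans (label-sym e) (trans (proj₂ root x (edge-sym e)) (xor-comm σ₀ (σ' x)))
    σ-ok {suc x} {suc y} x≢y e = trans (sym (label'-old e)) (σ'-ok (x≢y ∘ cong suc) (inj₁ e))

balanced⇒coboundary : ∀ {n} (G : SignedGraph n) → SignedGraph.Balanced G → SignedGraph.Coboundary G
balanced⇒coboundary {zero}  G _        = (λ ()) , λ { {()} }
balanced⇒coboundary {suc n} G balanced = coboundary-lift (balanced⇒coboundary G' balanced')
  where open Elimination G balanced

-- Integer signs and sign matrices

sgn : Bool → ℤ
sgn false = 1ℤ
sgn true  = -1ℤ

sgn-xor : ∀ a b → sgn (a xor b) ≡ sgn a * sgn b
sgn-xor false false = refl
sgn-xor false true  = refl
sgn-xor true  false = refl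
sgn-xor true  true  = refl

sgn*sgn* : ∀ b i → sgn b * (sgn b * i) ≡ i
sgn*sgn* false i = trans (*-identityˡ _) (*-identityˡ i)
sgn*sgn* true  i = trans (-1*i≡-i _) (trans (cong -_ (-1*i≡-i i)) (neg-involutive i))

sgn≡±1 : ∀ b → sgn b ≡ 1ℤ ⊎ sgn b ≡ - 1ℤ
sgn≡±1 false = inj₁ refl
sgn≡±1 true  = inj₂ refl

sameSign⇒sgn≡1 : ∀ b {i} → (i < 0ℤ × sgn b * i < 0ℤ) ⊎ (0ℤ < i × 0ℤ < sgn b * i) → b ≡ false
sameSign⇒sgn≡1 false _ = refl
sameSign⇒sgn≡1 true (inj₁ (i<0 , -i<0)) = ⊥-elim (<-asym (subst (_< 0ℤ) (-1*i≡-i _) -i<0) (neg-mono-< i<0))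
sameSign⇒sgn≡1 true (inj₂ (0<i , 0<-i)) = ⊥-elim (<-asym (subst (0ℤ <_) (-1*i≡-i _) 0<-i) (neg-mono-< 0<i))

isPositive : ℤ → Bool
isPositive i = does (0ℤ <? i)

∣i∣≡∣j∣⇒j≡sgn*i : ∀ i j → ∣ i ∣ ≡ ∣ j ∣ → j ≡ sgn (isPositive i xor isPositive j) * i
∣i∣≡∣j∣⇒j≡sgn*i (+ zero)  (+ zero)  refl = refl
∣i∣≡∣j∣⇒j≡sgn*i (+ zero)  +[1+ _ ]  ()
∣i∣≡∣j∣⇒j≡sgn*i (+ zero)  -[1+ _ ]  ()
∣i∣≡∣j∣⇒j≡sgn*i +[1+ _ ]  (+ zero)  ()
∣i∣≡∣j∣⇒j≡sgn*i -[1+ _ ]  (+ zero)  ()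
∣i∣≡∣j∣⇒j≡sgn*i i@(+[1+ _ ]) +[1+ _ ]  refl = sym (*-identityˡ i)
∣i∣≡∣j∣⇒j≡sgn*i i@(+[1+ _ ]) -[1+ _ ]  refl = sym (-1*i≡-i i)
∣i∣≡∣j∣⇒j≡sgn*i i@(-[1+ _ ]) +[1+ _ ]  refl = sym (-1*i≡-i i)
∣i∣≡∣j∣⇒j≡sgn*i i@(-[1+ _ ]) -[1+ _ ]  refl = sym (*-identityˡ i)

0<d*i⇔0<i : ∀ {d} i → 0ℤ < d → 0ℤ < d * i ⇔ 0ℤ < i
0<d*i⇔0<i {+ zero}   i (+<+ ())
0<d*i⇔0<i {+[1+ n ]} i _ = mk⇔
  (λ 0<di → *-cancelˡ-<-nonNeg +[1+ n ] (subst (_< +[1+ n ] * i) (sym (*-zeroʳ +[1+ n ])) 0<di))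
  (λ 0<i → subst (_< +[1+ n ] * i) (*-zeroʳ +[1+ n ]) (*-monoˡ-<-pos +[1+ n ] 0<i))

isPositive-cong : ∀ {d e} i j → 0ℤ < d → 0ℤ < e → d * i ≡ e * j → isPositive i ≡ isPositive j
isPositive-cong i j 0<d 0<e di≡ej = does-⇔
  (⇔.trans (⇔.sym (0<d*i⇔0<i i 0<d)) (⇔.trans (mk⇔ (subst (0ℤ <_) di≡ej) (subst (0ℤ <_) (sym di≡ej)))
                                                 (0<d*i⇔0<i j 0<e)))
  (0ℤ <? i) (0ℤ <? j)

nonAdjacent⇒zero : ∀ {n} {B : Matrix n} → SkewSymmetrizable B → ∀ {i j} → ¬ Adjacent B i j → B i j ≡ 0ℤ
nonAdjacent⇒zero {B = B} (d , d>0 , skew) {i} {j} ¬adj with <-cmp 0ℤ (B i j)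
... | tri< 0<Bij _ _ = ⊥-elim (¬adj (inj₁ 0<Bij))
... | tri≈ _ 0≡Bij _ = sym 0≡Bij
... | tri> _ _ Bij<0 = ⊥-elim (¬adj (inj₂ (to (0<d*i⇔0<i (B j i) (d>0 j)) (subst (0ℤ <_) d[-Bij]≡dBji
                         (from (0<d*i⇔0<i (- B i j) (d>0 i)) (neg-mono-< Bij<0))))))
  where
  d[-Bij]≡dBji : d i * - B i j ≡ d j * B j i
  d[-Bij]≡dBji = trans (sym (neg-distribʳ-* (d i) (B i j))) (trans (cong -_ (skew i j)) (neg-involutive _))

prodFin-sgn : ∀ {r} (t : Fin r → Bool) (x y : Fin r → ℤ) → (∀ a → y a ≡ sgn (t a) * x a) →
              prodFin y ≡ sgn (sum t) * prodFin x
prodFin-sgn {zero}  t x y y≡ = refl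
prodFin-sgn {suc r} t x y y≡ = begin
  y zero * prodFin (y ∘ suc)
    ≡⟨ cong₂ _*_ (y≡ zero) (prodFin-sgn (t ∘ suc) (x ∘ suc) (y ∘ suc) (y≡ ∘ suc)) ⟩
  (sgn (t zero) * x zero) * (sgn (sum (t ∘ suc)) * prodFin (x ∘ suc))
    ≡⟨ interchange (sgn (t zero)) (x zero) (sgn (sum (t ∘ suc))) (prodFin (x ∘ suc)) ⟩
  (sgn (t zero) * sgn (sum (t ∘ suc))) * (x zero * prodFin (x ∘ suc))
    ≡⟨ cong (_* prodFin x) (sgn-xor (t zero) (sum (t ∘ suc))) ⟨
  sgn (sum t) * prodFin x ∎

prodFin-ones : ∀ {n} → prodFin {n} (λ _ → 1ℤ) ≡ 1ℤ
prodFin-ones {zero}  = refl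
prodFin-ones {suc n} = trans (*-identityˡ _) (prodFin-ones {n})

sumFin-cong : ∀ {n} {f g : Fin n → ℤ} → (∀ a → f a ≡ g a) → sumFin f ≡ sumFin g
sumFin-cong {zero}  f≡g = refl
sumFin-cong {suc n} f≡g = cong₂ ℤ._+_ (f≡g zero) (sumFin-cong (f≡g ∘ suc))

sumFin-zero : ∀ {n} (f : Fin n → ℤ) → (∀ a → f a ≡ 0ℤ) → sumFin f ≡ 0ℤ
sumFin-zero {zero}  f _   = refl
sumFin-zero {suc n} f f≡0 = cong₂ ℤ._+_ (f≡0 zero) (sumFin-zero (f ∘ suc) (f≡0 ∘ suc))

diagonal : ∀ {n} → (Fin n → ℤ) → Matrix n
diagonal s zero    zero    = s zero
diagonal s zero    (suc j) = 0ℤ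
diagonal s (suc i) zero    = 0ℤ
diagonal s (suc i) (suc j) = diagonal (s ∘ suc) i j

sumFin-diagonalˡ : ∀ {n} (s f : Fin n → ℤ) i → sumFin (λ k → diagonal s k i * f k) ≡ s i * f i
sumFin-diagonalˡ {suc n} s f zero =
  trans (cong (ℤ._+_ (s zero * f zero)) (sumFin-zero _ (λ a → *-zeroˡ (f (suc a))))) (+-identityʳ _)
sumFin-diagonalˡ {suc n} s f (suc i) =
  trans (+-identityˡ _) (sumFin-diagonalˡ (s ∘ suc) (f ∘ suc) i)

sumFin-diagonalʳ : ∀ {n} (s f : Fin n → ℤ) j → sumFin (λ k → f k * diagonal s k j) ≡ f j * s j
sumFin-diagonalʳ {suc n} s f zero =
  trans (cong (ℤ._+_ (f zero * s zero)) (sumFin-zero _ (λ a → *-zeroʳ (f (suc a))))) (+-identityʳ _)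
sumFin-diagonalʳ {suc n} s f (suc j) =
  trans (cong (ℤ._+ sumFin (λ k → f (suc k) * diagonal (s ∘ suc) k j)) (*-zeroʳ (f zero)))
        (trans (+-identityˡ _) (sumFin-diagonalʳ (s ∘ suc) (f ∘ suc) j))

diagonal-congruence : ∀ {n} (s : Fin n → ℤ) (M : Matrix n) i j →
                      (transpose (diagonal s) · (M · diagonal s)) i j ≡ s i * (M i j * s j)
diagonal-congruence s M i j =
  trans (sumFin-cong (λ k → cong (diagonal s k i *_) (sumFin-diagonalʳ s (M k) j)))
        (sumFin-diagonalˡ s (λ k → M k j * s j) i)

det-diagonal : ∀ {n} (s : Fin n → ℤ) → det (diagonal s) ≡ prodFin s
det-diagonal {zero}  s = refl
-- In the Laplace expansion the first row is s zero followed by zeros and the first minor is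
-- diagonal (s ∘ suc), both definitionally.
det-diagonal {suc n} s = begin
  det (diagonal s)
    ≡⟨ cong₂ ℤ._+_ (*-identityˡ (s zero * det (diagonal (s ∘ suc))))
                   (sumFin-zero {n} (λ j → altSign (suc (toℕ j)) * 0ℤ) (λ j → *-zeroʳ (altSign (suc (toℕ j))))) ⟩
  s zero * det (diagonal (s ∘ suc)) ℤ.+ 0ℤ  ≡⟨ +-identityʳ _ ⟩
  s zero * det (diagonal (s ∘ suc))         ≡⟨ cong (s zero *_) (det-diagonal (s ∘ suc)) ⟩
  prodFin s                                 ∎

det-diagonal-sgn : ∀ {n} (σ : Fin n → Bool) → det (diagonal (sgn ∘ σ)) ≡ sgn (sum σ)
det-diagonal-sgn {n} σ = begin
  det (diagonal (sgn ∘ σ))            ≡⟨ det-diagonal (sgn ∘ σ) ⟩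
  prodFin (sgn ∘ σ)                   ≡⟨ prodFin-sgn σ (λ _ → 1ℤ) (sgn ∘ σ) (sym ∘ *-identityʳ ∘ sgn ∘ σ) ⟩
  sgn (sum σ) * prodFin {n} (λ _ → 1ℤ) ≡⟨ cong (sgn (sum σ) *_) (prodFin-ones {n}) ⟩
  sgn (sum σ) * 1ℤ                    ≡⟨ *-identityʳ (sgn (sum σ)) ⟩
  sgn (sum σ)                         ∎

signProduct : ∀ {n} → List (Fin n) → Fin n → ℤ
signProduct []       i = 1ℤ
signProduct (k ∷ ks) i = signAt k i * signProduct ks i

signChanges-entry : ∀ {n} ks (A : Matrix n) i j →
                    signChanges ks A i j ≡ signProduct ks i * (signProduct ks j * A i j)
signChanges-entry []       A i j = sym (trans (*-identityˡ _) (*-identityˡ _))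
signChanges-entry (k ∷ ks) A i j =
  trans (signChanges-entry ks (signChange k A) i j)
        (regroup (signProduct ks i) (signProduct ks j) (signAt k i) (signAt k j) (A i j))
  where
  regroup : ∀ a b c d x → a * (b * (c * (d * x))) ≡ (c * a) * ((d * b) * x)
  regroup = solve-∀

signChangesAt : ∀ {n} → (Fin n → Bool) → List (Fin n)
signChangesAt {zero}  σ = []
signChangesAt {suc n} σ = if σ zero then zero ∷ rest else rest
  where rest = map suc (signChangesAt (σ ∘ suc))

signProduct-map-suc-zero : ∀ {n} (ks : List (Fin n)) → signProduct (map suc ks) zero ≡ 1ℤ
signProduct-map-suc-zero []       = refl
signProduct-map-suc-zero (k ∷ ks) = trans (*-identityˡ _) (signProduct-map-suc-zero ks)

signProduct-map-suc : ∀ {n} (ks : List (Fin n)) i → signProduct (map suc ks) (suc i) ≡ signProduct ks i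
signProduct-map-suc []       i = refl
signProduct-map-suc (k ∷ ks) i = cong (signAt k i *_) (signProduct-map-suc ks i)

signProduct-ifZero-suc : ∀ {n} b (ks : List (Fin (suc n))) i →
                         signProduct (if b then zero ∷ ks else ks) (suc i) ≡ signProduct ks (suc i)
signProduct-ifZero-suc true  ks i = *-identityˡ _
signProduct-ifZero-suc false ks i = refl

signProduct-signChangesAt : ∀ {n} (σ : Fin n → Bool) i → signProduct (signChangesAt σ) i ≡ sgn (σ i)
signProduct-signChangesAt {suc n} σ zero with σ zero
... | true  = cong (-1ℤ *_) (signProduct-map-suc-zero (signChangesAt (σ ∘ suc)))
... | false = signProduct-map-suc-zero (signChangesAt (σ ∘ suc))
signProduct-signChangesAt {suc n} σ (suc i) = begin
  signProduct (signChangesAt σ) (suc i)           ≡⟨ signProduct-ifZero-suc (σ zero) _ i ⟩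
  signProduct (map suc (signChangesAt (σ ∘ suc))) (suc i)
                                                  ≡⟨ signProduct-map-suc (signChangesAt (σ ∘ suc)) i ⟩
  signProduct (signChangesAt (σ ∘ suc)) i         ≡⟨ signProduct-signChangesAt (σ ∘ suc) i ⟩
  sgn (σ (suc i))                                 ∎

SignConjugate : ∀ {n} → (Fin n → Bool) → Matrix n → Matrix n → Set
SignConjugate σ A A' = ∀ i j → A' i j ≡ sgn (σ i) * (sgn (σ j) * A i j)

signChanges-signChangesAt : ∀ {n} (σ : Fin n → Bool) {A A' : Matrix n} → SignConjugate σ A A' →
                            ∀ i j → signChanges (signChangesAt σ) A i j ≡ A' i j
signChanges-signChangesAt σ {A} A'≡ i j = begin
  signChanges (signChangesAt σ) A i j  ≡⟨ signChanges-entry (signChangesAt σ) A i j ⟩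
  _                                    ≡⟨ cong₂ (λ a b → a * (b * A i j)) (signProduct-signChangesAt σ i)
                                                                           (signProduct-signChangesAt σ j) ⟩
  sgn (σ i) * (sgn (σ j) * A i j)      ≡⟨ A'≡ i j ⟨
  _                                    ∎

signConjugate⇒equivalent : ∀ {n} (σ : Fin n → Bool) {A A' : Matrix n} → Symmetrizable A →
                          SignConjugate σ A A' → Equivalent A A'
signConjugate⇒equivalent σ {A} {A'} (d , d>0 , A-sym) A'≡ =
  d , (d>0 , A-sym) , (d>0 , A'-sym) , diagonal s
  , Sum.map (trans (det-diagonal-sgn σ)) (trans (det-diagonal-sgn σ)) (sgn≡±1 (sum σ)) , congruence
  where
  s : _ → ℤ
  s = sgn ∘ σ

  A'-sym : ∀ i j → d i * A' i j ≡ d j * A' j i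
  A'-sym i j = begin
    d i * A' i j                  ≡⟨ cong (d i *_) (A'≡ i j) ⟩
    d i * (s i * (s j * A i j))   ≡⟨ inward (d i) (s i) (s j) (A i j) ⟩
    s i * (s j * (d i * A i j))   ≡⟨ cong (λ x → s i * (s j * x)) (A-sym i j) ⟩
    s i * (s j * (d j * A j i))   ≡⟨ x∙yz≈y∙xz (s i) (s j) (d j * A j i) ⟩
    s j * (s i * (d j * A j i))   ≡⟨ inward (d j) (s j) (s i) (A j i) ⟨
    d j * (s j * (s i * A j i))   ≡⟨ cong (d j *_) (A'≡ j i) ⟨
    d j * A' j i                  ∎
    where
    inward : ∀ d a b x → d * (a * (b * x)) ≡ a * (b * (d * x))
    inward = solve-∀

  congruence : ∀ i j → diag· d A' i j ≡ (transpose (diagonal s) · (diag· d A · diagonal s)) i j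
  congruence i j = begin
    d i * A' i j                  ≡⟨ cong (d i *_) (A'≡ i j) ⟩
    d i * (s i * (s j * A i j))   ≡⟨ regroup (d i) (s i) (s j) (A i j) ⟩
    s i * ((d i * A i j) * s j)   ≡⟨ diagonal-congruence s (diag· d A) i j ⟨
    _                             ∎
    where
    regroup : ∀ d a b x → d * (a * (b * x)) ≡ a * ((d * x) * b)
    regroup = solve-∀

-- Admissible companions

flips : ∀ {n} → Matrix n → Matrix n → Fin n → Fin n → Bool
flips A A' i j = isPositive (A i j) xor isPositive (A' i j)

companions-flip : ∀ {n} {B A A' : Matrix n} → QuasiCartanCompanion B A → QuasiCartanCompanion B A' →
                  ∀ {i j} → i ≢ j → A' i j ≡ sgn (flips A A' i j) * A i j
companions-flip {A = A} {A'} (_ , A-abs) (_ , A'-abs) {i} {j} i≢j =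
  ∣i∣≡∣j∣⇒j≡sgn*i (A i j) (A' i j) (trans (A-abs i j i≢j) (sym (A'-abs i j i≢j)))

flipGraph : ∀ {n} (B A A' : Matrix n) → Symmetrizable A → Symmetrizable A' → SignedGraph n
flipGraph B A A' (d , d>0 , A-sym) (d' , d'>0 , A'-sym) = record
  { Edge      = Adjacent B
  ; edge?     = λ i j → (0ℤ <? B i j) ⊎-dec (0ℤ <? B j i)
  ; edge-sym  = Sum.swap
  ; label     = flips A A'
  ; label-sym = λ {i} {j} _ →
      cong₂ _xor_ (isPositive-cong (A i j) (A j i) (d>0 i) (d>0 j) (A-sym i j))
                  (isPositive-cong (A' i j) (A' j i) (d'>0 i) (d'>0 j) (A'-sym i j))
  }

-- Along a chordless cycle edgeProduct A' = ± edgeProduct A, and admissibility fixes the sign of both.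
flipGraph-balanced : ∀ {n} {B A A' : Matrix n}
                     (cA : QuasiCartanCompanion B A) (cA' : QuasiCartanCompanion B A') →
                     Admissible B A → Admissible B A' →
                     SignedGraph.Balanced (flipGraph B A A' (proj₁ (proj₁ cA)) (proj₁ (proj₁ cA')))
flipGraph-balanced {B = B} {A} {A'} cA cA' A-adm A'-adm {k} v v-inj v-ind =
  sameSign⇒sgn≡1 (parity v)
    (Sum.map (Prod.map₂ (subst (_< 0ℤ) product-flip)) (Prod.map₂ (subst (0ℤ <_) product-flip)) signs)
  where
  open SignedGraph (flipGraph B A A' (proj₁ (proj₁ cA)) (proj₁ (proj₁ cA'))) using (parity)

  Z : Cycle B
  Z = record { r = 3 + k ; r≥3 = s≤s (s≤s (s≤s z≤n)) ; v = v ; v-inj = v-inj ; induced = v-ind }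

  product-flip : edgeProduct A' Z ≡ sgn (parity v) * edgeProduct A Z
  product-flip = prodFin-sgn (λ a → flips A A' (v a) (v (cycSuc a))) (λ a → - A (v a) (v (cycSuc a)))
    (λ a → - A' (v a) (v (cycSuc a))) λ a →
    trans (cong -_ (companions-flip {B = B} cA cA' (cycSuc-≢ a ∘ v-inj)))
          (neg-distribʳ-* (sgn (flips A A' (v a) (v (cycSuc a)))) (A (v a) (v (cycSuc a))))

  signs : (edgeProduct A Z < 0ℤ × edgeProduct A' Z < 0ℤ) ⊎ (0ℤ < edgeProduct A Z × 0ℤ < edgeProduct A' Z)
  signs with (all? λ a → 0ℤ <? B (v a) (v (cycSuc a))) ⊎-dec (all? λ a → 0ℤ <? B (v (cycSuc a)) (v a))
  ... | yes oriented = inj₁ (proj₁ (A-adm Z) oriented , proj₁ (A'-adm Z) oriented)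
  ... | no ¬oriented = inj₂ (proj₂ (A-adm Z) ¬oriented , proj₂ (A'-adm Z) ¬oriented)

coboundary⇒signConjugate : ∀ {n} {B A A' : Matrix n} → SkewSymmetrizable B →
  QuasiCartanCompanion B A → QuasiCartanCompanion B A' → (σ : Fin n → Bool) →
  (∀ {i j} → i ≢ j → Adjacent B i j → flips A A' i j ≡ σ i xor σ j) → SignConjugate σ A A'
coboundary⇒signConjugate {B = B} {A} {A'} skew
  cA@((_ , A-diag) , A-abs) cA'@((_ , A'-diag) , A'-abs) σ σ-ok i j with i ≟ j
... | yes refl = trans (trans (A'-diag i) (sym (A-diag i))) (sym (sgn*sgn* (σ i) (A i i)))
... | no i≢j with (0ℤ <? B i j) ⊎-dec (0ℤ <? B j i)
...   | yes adj = begin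
  A' i j                           ≡⟨ companions-flip {B = B} cA cA' i≢j ⟩
  sgn (flips A A' i j) * A i j     ≡⟨ cong (λ b → sgn b * A i j) (σ-ok i≢j adj) ⟩
  sgn (σ i xor σ j) * A i j        ≡⟨ cong (_* A i j) (sgn-xor (σ i) (σ j)) ⟩
  (sgn (σ i) * sgn (σ j)) * A i j  ≡⟨ *-assoc (sgn (σ i)) (sgn (σ j)) (A i j) ⟩
  sgn (σ i) * (sgn (σ j) * A i j)  ∎
...   | no ¬adj = begin
  A' i j                           ≡⟨ zero-entry {A'} A'-abs ⟩
  0ℤ                               ≡⟨ *-zeroʳ (sgn (σ i)) ⟨
  sgn (σ i) * 0ℤ                   ≡⟨ cong (sgn (σ i) *_) (*-zeroʳ (sgn (σ j))) ⟨
  sgn (σ i) * (sgn (σ j) * 0ℤ)     ≡⟨ cong (λ x → sgn (σ i) * (sgn (σ j) * x)) (zero-entry {A} A-abs) ⟨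
  sgn (σ i) * (sgn (σ j) * A i j)  ∎
  where
  zero-entry : ∀ {M : Matrix _} → (∀ i j → i ≢ j → ∣ M i j ∣ ≡ ∣ B i j ∣) → M i j ≡ 0ℤ
  zero-entry M-abs = ∣i∣≡0⇒i≡0 (trans (M-abs i j i≢j) (cong ∣_∣ (nonAdjacent⇒zero skew ¬adj)))

theorem2p11 : (n : ℕ) (B A A' : Matrix n) → SkewSymmetrizable B →
    AdmissibleCompanion B A → AdmissibleCompanion B A' →
    (Σ (List _) λ ks → ∀ i j → signChanges ks A i j ≡ A' i j) × Equivalent A A'
theorem2p11 n B A A' skew (cA , A-adm) (cA' , A'-adm) =
    (signChangesAt σ , signChanges-signChangesAt σ A'≡SAS)
  , signConjugate⇒equivalent σ (proj₁ (proj₁ cA)) A'≡SAS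
  where
  G : SignedGraph n
  G = flipGraph B A A' (proj₁ (proj₁ cA)) (proj₁ (proj₁ cA'))

  coboundary : SignedGraph.Coboundary G
  coboundary = balanced⇒coboundary G (flipGraph-balanced {B = B} cA cA' A-adm A'-adm)

  σ : Fin n → Bool
  σ = proj₁ coboundary

  A'≡SAS : SignConjugate σ A A'
  A'≡SAS = coboundary⇒signConjugate skew cA cA' σ (proj₂ coboundary)
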